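{- For all formulas $\phi\in\mathcal{L}_{\Box\Diamond}$, the $\mathcal{L}_2$-formulas $(\Diamond_N\Box_{\ni}\phi^t\wedge\Box_N\Diamond_{\ni}\neg\phi^t)\to\bot$ and $(\Diamond_N\Box_{\ni}\top\to\Box_N\Diamond_{\ni}\phi^t)\to\Box_N\Diamond_{\ni}\phi^t$ (the translations of $(\Box\phi\wedge\Diamond\neg\phi)\to\bot$ and $(\Box\top\to\Diamond\phi)\to\Diamond\phi$) are derivable in $\mathsf{IK}_2$ (from the empty set of assumptions).
   Context: $\mathcal{L}_{\Box\Diamond}$: formulas $\phi ::= p_i \mid \bot \mid \phi\wedge\phi \mid \phi\vee\phi \mid \phi\to\phi \mid \Box\phi\mid\Diamond\phi$; $\mathcal{L}_2$: formulas $\phi ::= p_i\mid\bot\mid\phi\wedge\phi\mid\phi\vee\phi\mid\phi\to\phi\mid\Box_N\phi\mid\Diamond_N\phi\mid\Box_{\ni}\phi\mid\Diamond_{\ni}\phi$, over the same countable set of proposition letters; $\neg\phi:=\phi\to\bot$, $\top:=\neg\bot$. Translation $(-)^t:\mathcal{L}_{\Box\Diamond}\to\mathcal{L}_2$: $p^t=p$ for $p$ a letter or $\bot$; $(\phi\star\psi)^t=\phi^t\star\psi^t$ for $\star\in\{\wedge,\vee,\to\}$; $(\Box\phi)^t=\Diamond_N\Box_{\ni}\phi^t$; $(\Diamond\phi)^t=\Box_N\Diamond_{\ni}\phi^t$. $\mathsf{IK}_2$: generalised Hilbert calculus whose axioms are all substitution instances of a standard axiomatisation of intuitionistic propositional logic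 and, for each $j\in\{N,\ni\}$, of $\Box_j(p\to q)\to(\Box_jp\to\Box_jq)$, $\Box_j(p\to q)\to(\Diamond_jp\to\Diamond_jq)$, $\neg\Diamond_j\bot$, $\Diamond_j(p\vee q)\to(\Diamond_jp\vee\Diamond_jq)$, $(\Diamond_jp\to\Box_jq)\to\Box_j(p\to q)$; rules (El) $\Gamma\vdash\phi$ for $\phi\in\Gamma$; (Ax) $\Gamma\vdash\psi$ for each axiom; (MP) from $\Gamma\vdash\phi$ and $\Gamma\vdash\phi\to\psi$ infer $\Gamma\vdash\psi$; (Nec) from $\emptyset\vdash\phi$ infer $\Gamma\vdash\Box_j\phi$. -}

module Defs where

open import Data.Nat using (ℕ)
open import Level using (0ℓ)
open import Relation.Unary using (Pred; _∈_; ∅)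

data Fm : Set where
  var  : ℕ → Fm
  ⊥'   : Fm
  _∧'_ : Fm → Fm → Fm
  _∨'_ : Fm → Fm → Fm
  _⇒_  : Fm → Fm → Fm
  □_   : Fm → Fm
  ◇_   : Fm → Fm

data Idx : Set where
  N  : Idx
  Ni : Idx   -- the index ∋

data Fm2 : Set where
  var  : ℕ → Fm2
  ⊥'   : Fm2
  _∧'_ : Fm2 → Fm2 → Fm2
  _∨'_ : Fm2 → Fm2 → Fm2
  _⇒_  : Fm2 → Fm2 → Fm2
  □[_]_ : Idx → Fm2 → Fm2
  ◇[_]_ : Idx → Fm2 → Fm2

infixr 6 _∧'_
infixr 5 _∨'_
infixr 4 _⇒_
infix 7 □_ ◇_ □[_]_ ◇[_]_

¬' : Fm2 → Fm2
¬' φ = φ ⇒ ⊥'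

⊤' : Fm2
⊤' = ¬' ⊥'

tr : Fm → Fm2
tr (var p)   = var p
tr ⊥'        = ⊥'
tr (φ ∧' ψ)  = tr φ ∧' tr ψ
tr (φ ∨' ψ)  = tr φ ∨' tr ψ
tr (φ ⇒ ψ)   = tr φ ⇒ tr ψ
tr (□ φ)     = ◇[ N ] □[ Ni ] tr φ
tr (◇ φ)     = □[ N ] ◇[ Ni ] tr φ

-- Since the schemes are given with metavariables
-- ranging over all formulas, this set is closed under substitution.
data Axiom : Fm2 → Set where
  ax-K    : ∀ φ ψ → Axiom (φ ⇒ ψ ⇒ φ)
  ax-S    : ∀ φ ψ χ → Axiom ((φ ⇒ ψ ⇒ χ) ⇒ (φ ⇒ ψ) ⇒ φ ⇒ χ)
  ax-∧I   : ∀ φ ψ → Axiom (φ ⇒ ψ ⇒ φ ∧' ψ)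
  ax-∧E₁  : ∀ φ ψ → Axiom (φ ∧' ψ ⇒ φ)
  ax-∧E₂  : ∀ φ ψ → Axiom (φ ∧' ψ ⇒ ψ)
  ax-∨I₁  : ∀ φ ψ → Axiom (φ ⇒ φ ∨' ψ)
  ax-∨I₂  : ∀ φ ψ → Axiom (ψ ⇒ φ ∨' ψ)
  ax-∨E   : ∀ φ ψ χ → Axiom ((φ ⇒ χ) ⇒ (ψ ⇒ χ) ⇒ φ ∨' ψ ⇒ χ)
  ax-⊥E   : ∀ φ → Axiom (⊥' ⇒ φ)
  ax-k□   : ∀ j φ ψ → Axiom (□[ j ] (φ ⇒ ψ) ⇒ □[ j ] φ ⇒ □[ j ] ψ)
  ax-k◇   : ∀ j φ ψ → Axiom (□[ j ] (φ ⇒ ψ) ⇒ ◇[ j ] φ ⇒ ◇[ j ] ψ)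
  ax-n◇   : ∀ j → Axiom (¬' (◇[ j ] ⊥'))
  ax-dis  : ∀ j φ ψ → Axiom (◇[ j ] (φ ∨' ψ) ⇒ ◇[ j ] φ ∨' ◇[ j ] ψ)
  ax-FS   : ∀ j φ ψ → Axiom ((◇[ j ] φ ⇒ □[ j ] ψ) ⇒ □[ j ] (φ ⇒ ψ))

data _⊢_ (Γ : Pred Fm2 0ℓ) : Fm2 → Set₁ where
  el  : ∀ {φ} → φ ∈ Γ → Γ ⊢ φ
  ax  : ∀ {φ} → Axiom φ → Γ ⊢ φ
  mp  : ∀ {φ ψ} → Γ ⊢ φ → Γ ⊢ (φ ⇒ ψ) → Γ ⊢ ψ
  nec : ∀ {φ} j → ∅ ⊢ φ → Γ ⊢ □[ j ] φ

infix 2 _⊢_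

{-# OPTIONS --safe #-}
module Submission where

-- Both formulas are proved by pushing a propositional tautology under the
-- modalities.  A ◇ and a □ over formulas that refute each other are jointly
-- absurd (K for ◇ plus ¬◇⊥); applying this at index ∋ to A and ¬A, and then at
-- index N to □_∋ A and ◇_∋ ¬A, gives the first formula.  For the second, the
-- Fischer Servi axiom turns ◇_N □_∋ ⊤ ⇒ □_N ◇_∋ A into □_N (□_∋ ⊤ ⇒ ◇_∋ A),
-- and since □_∋ ⊤ is a theorem by necessitation the premise can be discharged
-- under □_N.

open import Defs
open import Data.Product using (_×_; _,_)
open import Data.Sum using (inj₁; inj₂)
open import Level using (0ℓ)
open import Relation.Binary.PropositionalEquality using (refl)
open import Relation.Unary using (Pred; ∅; _∪_; ｛_｝)

_▸_ : Pred Fm2 0ℓ → Fm2 → Pred Fm2 0ℓ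
Γ ▸ ψ = Γ ∪ ｛ ψ ｝

infixl 3 _▸_

private
  variable
    Γ : Pred Fm2 0ℓ
    φ ψ χ : Fm2

⊢-refl : Γ ⊢ φ ⇒ φ
⊢-refl {φ = φ} = mp (ax (ax-K φ φ)) (mp (ax (ax-K φ (φ ⇒ φ))) (ax (ax-S φ (φ ⇒ φ) φ)))

⊢-⊤ : Γ ⊢ ⊤'
⊢-⊤ = ⊢-refl

assumption : Γ ▸ φ ⊢ φ
assumption = el (inj₂ refl)

weaken : Γ ⊢ φ → Γ ▸ ψ ⊢ φ
weaken (el φ∈Γ) = el (inj₁ φ∈Γ)
weaken (ax a)    = ax a
weaken (mp d e)  = mp (weaken d) (weaken e)
weaken (nec j d) = nec j d

const : Γ ⊢ φ → Γ ⊢ ψ ⇒ φ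
const d = mp d (ax (ax-K _ _))

deduction : Γ ▸ ψ ⊢ φ → Γ ⊢ ψ ⇒ φ
deduction (el (inj₁ φ∈Γ)) = const (el φ∈Γ)
deduction (el (inj₂ refl)) = ⊢-refl
deduction (ax a)           = const (ax a)
deduction (mp d e)         = mp (deduction d) (mp (deduction e) (ax (ax-S _ _ _)))
deduction (nec j d)        = const (nec j d)

∧-uncurry : Γ ⊢ φ ⇒ ψ ⇒ χ → Γ ⊢ φ ∧' ψ ⇒ χ
∧-uncurry d = deduction (mp (mp assumption (ax (ax-∧E₂ _ _)))
                            (mp (mp assumption (ax (ax-∧E₁ _ _))) (weaken d)))

¬¬-intro : Γ ⊢ φ ⇒ ¬' (¬' φ)
¬¬-intro = deduction (deduction (mp (weaken assumption) assumption))

□-mono : ∀ j → ∅ ⊢ φ ⇒ ψ → Γ ⊢ □[ j ] φ ⇒ □[ j ] ψ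
□-mono j d = mp (nec j d) (ax (ax-k□ j _ _))

◇□-refute : ∀ j → ∅ ⊢ ψ ⇒ ¬' φ → Γ ⊢ ◇[ j ] φ ⇒ □[ j ] ψ ⇒ ⊥'
◇□-refute {ψ = ψ} {φ = φ} {Γ = Γ} j ψ⇒¬φ =
  deduction (deduction (mp ◇⊥ (ax (ax-n◇ j))))
  where
  ◇⊥ : Γ ▸ ◇[ j ] φ ▸ □[ j ] ψ ⊢ ◇[ j ] ⊥'
  ◇⊥ = mp (weaken assumption) (mp (mp assumption (□-mono j ψ⇒¬φ)) (ax (ax-k◇ j φ ⊥')))

◇⇒□-discharge : ∀ j → ∅ ⊢ χ → Γ ⊢ (◇[ j ] χ ⇒ □[ j ] ψ) ⇒ □[ j ] ψ
◇⇒□-discharge j ⊢χ =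
  deduction (mp (mp assumption (ax (ax-FS j _ _)))
                (□-mono j (deduction (mp (weaken ⊢χ) assumption))))

lemma4p14 : ∀ (φ : Fm) →
    (∅ ⊢ ((◇[ N ] □[ Ni ] tr φ) ∧' (□[ N ] ◇[ Ni ] ¬' (tr φ))) ⇒ ⊥')
    × (∅ ⊢ ((◇[ N ] □[ Ni ] ⊤') ⇒ (□[ N ] ◇[ Ni ] tr φ)) ⇒ (□[ N ] ◇[ Ni ] tr φ))
lemma4p14 φ = ∧-uncurry (◇□-refute N (◇□-refute Ni ¬¬-intro))
            , ◇⇒□-discharge N (nec Ni ⊢-⊤)
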